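{- If $j$ and $s$ are non-negative integers, then \[ \tau ^s A_j (\tau ) - \sigma ^s A_j (\sigma ) = \Delta \sum_{t = 0}^j A(j,t)u_{t + s},\qquad \tau ^s A_j (\tau ) + \sigma ^s A_j (\sigma ) = \sum_{t = 0}^j A(j,t)v_{t + s}. \]
   Context: Let $q$ be a nonzero complex number, $\Delta=\sqrt{1-4q}$ (a fixed square root), $\tau=(1+\Delta)/2$, $\sigma=(1-\Delta)/2$. Let $(u_j)$ and $(v_j)$ be defined by $u_0=0$, $u_1=1$, $v_0=2$, $v_1=1$ and $x_j=x_{j-1}-qx_{j-2}$ ($j\ge2$) for both sequences. The Eulerian numbers are $A(i,j)=\sum_{t=0}^j(-1)^t\binom{i+1}{t}(j-t)^i$ for non-negative integers $i,j$ (with $0^0=1$), and $A_i(x)=\sum_{j=0}^iA(i,j)x^j$. -}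

module Defs where

open import Level using (Level)
open import Data.Nat using (ℕ; zero; suc; _∸_; _^_)
open import Data.Nat.Combinatorics using (_C_)
open import Data.Integer as ℤ using (ℤ; +_; -[1+_])
open import Algebra.Bundles using (CommutativeRing)
open import Data.Product using (_×_; _,_; proj₁; proj₂)

sumTo : ∀ {a} {A : Set a} → (A → A → A) → A → ℕ → (ℕ → A) → A
sumTo _+_ 0# zero    f = f zero
sumTo _+_ 0# (suc j) f = sumTo _+_ 0# j f + f (suc j)

-- Integer Eulerian numbers, exactly as defined in the paper:
-- A(i,j) = Σ_{t=0}^j (-1)^t C(i+1,t) (j-t)^i   (with 0^0 = 1, as for ℕ._^_)
signPow : ℕ → ℤ
signPow zero    = ℤ.+ 1
signPow (suc t) = ℤ.- signPow t

euler : ℕ → ℕ → ℤ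
euler i j = sumTo ℤ._+_ (ℤ.+ 0) j
  (λ t → signPow t ℤ.* ((+ (suc i C t)) ℤ.* (+ ((j ∸ t) ^ i))))

module _ {c ℓ : Level} (R : CommutativeRing c ℓ) where
  open CommutativeRing R

  fromℕ : ℕ → Carrier
  fromℕ zero    = 0#
  fromℕ (suc n) = 1# + fromℕ n

  fromℤ : ℤ → Carrier
  fromℤ (+ n)      = fromℕ n
  fromℤ -[1+ n ]   = - fromℕ (suc n)

  pow : Carrier → ℕ → Carrier
  pow x zero    = 1#
  pow x (suc n) = x * pow x n

  Σ≤ : ℕ → (ℕ → Carrier) → Carrier
  Σ≤ j f = sumTo _+_ 0# j f

  eulerPoly : ℕ → Carrier → Carrier
  eulerPoly i x = Σ≤ i (λ j → fromℤ (euler i j) * pow x j)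

  lucasUV : Carrier → ℕ → Carrier × Carrier
  lucasUV q zero    = 0# , 2'
    where 2' = 1# + 1#
  lucasUV q (suc zero) = 1# , 1#
  lucasUV q (suc (suc n)) =
    (proj₁ (lucasUV q (suc n)) - q * proj₁ (lucasUV q n)) ,
    (proj₂ (lucasUV q (suc n)) - q * proj₂ (lucasUV q n))

  lucasU : Carrier → ℕ → Carrier
  lucasU q n = proj₁ (lucasUV q n)

  lucasV : Carrier → ℕ → Carrier
  lucasV q n = proj₂ (lucasUV q n)

{-# OPTIONS --safe #-}
module Submission where

-- τ and σ are the roots of X² − X + q, so they satisfy the Lucas recurrence and
-- Binet's formulas τⁿ − σⁿ = Δ uₙ, τⁿ + σⁿ = vₙ hold. Multiplying A_j(x) by x^s
-- shifts every exponent t to t + s, and both identities follow termwise by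
-- linearity; nothing about the coefficients A(j,t) is used.

open import Defs
open import Level using (Level)
open import Data.Nat using (ℕ; zero; suc)
import Data.Nat as ℕ
import Data.Nat.Properties as ℕ
open import Data.Integer as ℤ using (+_; -[1+_]; _⊖_; _◃_)
import Data.Integer.Properties as ℤ
import Data.Sign as Sign
open import Data.Maybe using (Maybe; map)
open import Data.Product using (_×_; _,_)
open import Relation.Nullary using (¬_)
open import Relation.Binary.Consequences using (dec⇒weaklyDec)
import Relation.Binary.PropositionalEquality as ≡
open import Algebra.Bundles using (CommutativeRing)
open import Algebra.Solver.Ring.AlmostCommutativeRing
  using (_-Raw-AlmostCommutative⟶_; fromCommutativeRing)

module _ {c ℓ} (R : CommutativeRing c ℓ) where
  open CommutativeRing R hiding (zero)
  open import Algebra.Properties.Ring ring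
  open import Algebra.Properties.CommutativeSemigroup +-commutativeSemigroup
    using (interchange)
  open import Algebra.Properties.CommutativeSemigroup *-commutativeSemigroup
    using (x∙yz≈y∙xz)
  open import Relation.Binary.Reasoning.Setoid setoid

  fromℕ-+ : ∀ m n → fromℕ R (m ℕ.+ n) ≈ fromℕ R m + fromℕ R n
  fromℕ-+ zero    n = sym (+-identityˡ _)
  fromℕ-+ (suc m) n = trans (+-congˡ (fromℕ-+ m n)) (sym (+-assoc _ _ _))

  fromℕ-* : ∀ m n → fromℕ R (m ℕ.* n) ≈ fromℕ R m * fromℕ R n
  fromℕ-* zero    n = sym (zeroˡ _)
  fromℕ-* (suc m) n = begin
    fromℕ R (n ℕ.+ m ℕ.* n)              ≈⟨ fromℕ-+ n (m ℕ.* n) ⟩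
    fromℕ R n + fromℕ R (m ℕ.* n)        ≈⟨ +-cong (sym (*-identityˡ _)) (fromℕ-* m n) ⟩
    1# * fromℕ R n + fromℕ R m * fromℕ R n ≈⟨ sym (distribʳ _ _ _) ⟩
    (1# + fromℕ R m) * fromℕ R n         ∎

  [x+y]-[x+z]≈y-z : ∀ x y z → (x + y) - (x + z) ≈ y - z
  [x+y]-[x+z]≈y-z x y z = begin
    (x + y) + - (x + z)   ≈⟨ +-congˡ (sym (-‿+-comm x z)) ⟩
    (x + y) + (- x + - z) ≈⟨ interchange x y (- x) (- z) ⟩
    (x - x) + (y - z)     ≈⟨ +-congʳ (-‿inverseʳ x) ⟩
    0# + (y - z)          ≈⟨ +-identityˡ _ ⟩
    y - z                 ∎

  fromℤ-⊖ : ∀ m n → fromℤ R (m ⊖ n) ≈ fromℕ R m - fromℕ R n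
  fromℤ-⊖ m       zero    = trans (sym (+-identityʳ _)) (+-congˡ (sym -0#≈0#))
  fromℤ-⊖ zero    (suc n) = sym (+-identityˡ _)
  fromℤ-⊖ (suc m) (suc n) = begin
    fromℤ R (suc m ⊖ suc n)                    ≡⟨ ≡.cong (fromℤ R) (ℤ.[1+m]⊖[1+n]≡m⊖n m n) ⟩
    fromℤ R (m ⊖ n)                            ≈⟨ fromℤ-⊖ m n ⟩
    fromℕ R m - fromℕ R n                      ≈⟨ sym ([x+y]-[x+z]≈y-z 1# _ _) ⟩
    fromℕ R (suc m) - fromℕ R (suc n)          ∎

  fromℤ-‿ : ∀ i → fromℤ R (ℤ.- i) ≈ - fromℤ R i
  fromℤ-‿ (+ zero)  = sym -0#≈0#
  fromℤ-‿ (+ suc n) = refl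
  fromℤ-‿ -[1+ n ]  = sym (-‿involutive _)

  fromℤ-+ : ∀ i j → fromℤ R (i ℤ.+ j) ≈ fromℤ R i + fromℤ R j
  fromℤ-+ (+ m)    (+ n)    = fromℕ-+ m n
  fromℤ-+ (+ m)    -[1+ n ] = fromℤ-⊖ m (suc n)
  fromℤ-+ -[1+ m ] (+ n)    = trans (fromℤ-⊖ n (suc m)) (+-comm _ _)
  fromℤ-+ -[1+ m ] -[1+ n ] = begin
    - fromℕ R (suc (suc (m ℕ.+ n)))          ≡⟨ ≡.cong (λ k → - fromℕ R (suc k)) (≡.sym (ℕ.+-suc m n)) ⟩
    - fromℕ R (suc m ℕ.+ suc n)              ≈⟨ -‿cong (fromℕ-+ (suc m) (suc n)) ⟩
    - (fromℕ R (suc m) + fromℕ R (suc n))    ≈⟨ sym (-‿+-comm _ _) ⟩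
    - fromℕ R (suc m) + - fromℕ R (suc n)    ∎

  fromℤ-+◃ : ∀ n → fromℤ R (Sign.+ ◃ n) ≈ fromℕ R n
  fromℤ-+◃ zero    = refl
  fromℤ-+◃ (suc n) = refl

  fromℤ--◃ : ∀ n → fromℤ R (Sign.- ◃ n) ≈ - fromℕ R n
  fromℤ--◃ zero    = sym -0#≈0#
  fromℤ--◃ (suc n) = refl

  fromℤ-* : ∀ i j → fromℤ R (i ℤ.* j) ≈ fromℤ R i * fromℤ R j
  fromℤ-* (+ m)    (+ n)    = trans (fromℤ-+◃ (m ℕ.* n)) (fromℕ-* m n)
  fromℤ-* (+ m)    -[1+ n ] = begin
    fromℤ R (Sign.- ◃ (m ℕ.* suc n))    ≈⟨ fromℤ--◃ (m ℕ.* suc n) ⟩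
    - fromℕ R (m ℕ.* suc n)             ≈⟨ -‿cong (fromℕ-* m (suc n)) ⟩
    - (fromℕ R m * fromℕ R (suc n))     ≈⟨ -‿distribʳ-* _ _ ⟩
    fromℕ R m * - fromℕ R (suc n)       ∎
  fromℤ-* -[1+ m ] (+ n)    = begin
    fromℤ R (Sign.- ◃ (suc m ℕ.* n))    ≈⟨ fromℤ--◃ (suc m ℕ.* n) ⟩
    - fromℕ R (suc m ℕ.* n)             ≈⟨ -‿cong (fromℕ-* (suc m) n) ⟩
    - (fromℕ R (suc m) * fromℕ R n)     ≈⟨ -‿distribˡ-* _ _ ⟩
    - fromℕ R (suc m) * fromℕ R n       ∎
  fromℤ-* -[1+ m ] -[1+ n ] = begin
    fromℤ R (Sign.+ ◃ (suc m ℕ.* suc n)) ≈⟨ fromℤ-+◃ (suc m ℕ.* suc n) ⟩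
    fromℕ R (suc m ℕ.* suc n)            ≈⟨ fromℕ-* (suc m) (suc n) ⟩
    a * b                                ≈⟨ sym (-‿involutive _) ⟩
    - - (a * b)                          ≈⟨ -‿cong (-‿distribʳ-* a b) ⟩
    - (a * - b)                          ≈⟨ -‿distribˡ-* a (- b) ⟩
    - a * - b                            ∎
    where
    a b : Carrier
    a = fromℕ R (suc m)
    b = fromℕ R (suc n)

  fromℤ-homomorphism :
    CommutativeRing.rawRing ℤ.+-*-commutativeRing -Raw-AlmostCommutative⟶ fromCommutativeRing R
  fromℤ-homomorphism = record
    { ⟦_⟧    = fromℤ R
    ; +-homo = fromℤ-+
    ; *-homo = fromℤ-*
    ; -‿homo = fromℤ-‿
    ; 0-homo = refl
    ; 1-homo = +-identityʳ 1#
    }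

  fromℤ-≈? : ∀ i j → Maybe (fromℤ R i ≈ fromℤ R j)
  fromℤ-≈? i j = map (λ { ≡.refl → refl }) (dec⇒weaklyDec ℤ._≟_ i j)

  open import Algebra.Solver.Ring
    (CommutativeRing.rawRing ℤ.+-*-commutativeRing) (fromCommutativeRing R)
    fromℤ-homomorphism fromℤ-≈?
    using (solve; _:=_; _:+_; _:*_; _:-_; con)

  Σ≤-cong : ∀ j {f g : ℕ → Carrier} → (∀ t → f t ≈ g t) → Σ≤ R j f ≈ Σ≤ R j g
  Σ≤-cong zero    f≈g = f≈g zero
  Σ≤-cong (suc j) f≈g = +-cong (Σ≤-cong j f≈g) (f≈g (suc j))

  Σ≤-distrib-+ : ∀ j (f g : ℕ → Carrier) →
                 Σ≤ R j (λ t → f t + g t) ≈ Σ≤ R j f + Σ≤ R j g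
  Σ≤-distrib-+ zero    f g = refl
  Σ≤-distrib-+ (suc j) f g = trans (+-congʳ (Σ≤-distrib-+ j f g)) (interchange _ _ _ _)

  Σ≤-distrib-‿ : ∀ j (f : ℕ → Carrier) → Σ≤ R j (λ t → - f t) ≈ - Σ≤ R j f
  Σ≤-distrib-‿ zero    f = refl
  Σ≤-distrib-‿ (suc j) f = trans (+-congʳ (Σ≤-distrib-‿ j f)) (-‿+-comm _ _)

  Σ≤-distrib-sub : ∀ j (f g : ℕ → Carrier) →
                 Σ≤ R j (λ t → f t - g t) ≈ Σ≤ R j f - Σ≤ R j g
  Σ≤-distrib-sub j f g =
    trans (Σ≤-distrib-+ j f (λ t → - g t)) (+-congˡ (Σ≤-distrib-‿ j g))

  *-distribˡ-Σ≤ : ∀ j x (f : ℕ → Carrier) → x * Σ≤ R j f ≈ Σ≤ R j (λ t → x * f t)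
  *-distribˡ-Σ≤ zero    x f = refl
  *-distribˡ-Σ≤ (suc j) x f = trans (distribˡ _ _ _) (+-congʳ (*-distribˡ-Σ≤ j x f))

  pow-+ : ∀ x m n → pow R x (m ℕ.+ n) ≈ pow R x m * pow R x n
  pow-+ x zero    n = sym (*-identityˡ _)
  pow-+ x (suc m) n = trans (*-congˡ (pow-+ x m n)) (sym (*-assoc _ _ _))

  polynomial : (ℕ → Carrier) → ℕ → Carrier → Carrier
  polynomial a j x = Σ≤ R j (λ t → a t * pow R x t)

  pow-*-polynomial : ∀ a j s x →
    pow R x s * polynomial a j x ≈ Σ≤ R j (λ t → a t * pow R x (t ℕ.+ s))
  pow-*-polynomial a j s x = trans (*-distribˡ-Σ≤ j _ _) (Σ≤-cong j λ t → begin
    pow R x s * (a t * pow R x t)   ≈⟨ x∙yz≈y∙xz _ _ _ ⟩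
    a t * (pow R x s * pow R x t)   ≈⟨ *-congˡ (*-comm _ _) ⟩
    a t * (pow R x t * pow R x s)   ≈⟨ *-congˡ (sym (pow-+ x t s)) ⟩
    a t * pow R x (t ℕ.+ s)         ∎)

  root-pow-recurrence : ∀ {q z} → z * z ≈ z - q →
    ∀ n → pow R z (suc (suc n)) ≈ pow R z (suc n) - q * pow R z n
  root-pow-recurrence {q} {z} z²≈z-q n = begin
    z * (z * pow R z n)           ≈⟨ sym (*-assoc _ _ _) ⟩
    (z * z) * pow R z n           ≈⟨ *-congʳ z²≈z-q ⟩
    (z - q) * pow R z n           ≈⟨ [y-z]x≈yx-zx _ _ _ ⟩
    z * pow R z n - q * pow R z n ∎

  vieta-root : ∀ {q x y} → x + y ≈ 1# → x * y ≈ q → x * x ≈ x - q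
  vieta-root {q} {x} {y} x+y≈1 x*y≈q = begin
    x * x               ≈⟨ solve 2 (λ x y → x :* x := x :* (x :+ y) :- x :* y) refl x y ⟩
    x * (x + y) - x * y ≈⟨ +-cong (trans (*-congˡ x+y≈1) (*-identityʳ x)) (-‿cong x*y≈q) ⟩
    x - q               ∎

  module _ {q x y : Carrier} (x+y≈1 : x + y ≈ 1#) (x*y≈q : x * y ≈ q) where

    x²≈x-q : x * x ≈ x - q
    x²≈x-q = vieta-root x+y≈1 x*y≈q

    y²≈y-q : y * y ≈ y - q
    y²≈y-q = vieta-root (trans (+-comm y x) x+y≈1) (trans (*-comm y x) x*y≈q)

    binet-lucasU : ∀ n → pow R x n - pow R y n ≈ (x - y) * lucasU R q n
    binet-lucasU zero          = trans (-‿inverseʳ 1#) (sym (zeroʳ _))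
    binet-lucasU (suc zero)    = sym ([y-z]x≈yx-zx 1# x y)
    binet-lucasU (suc (suc n)) = begin
      pow R x (2 ℕ.+ n) - pow R y (2 ℕ.+ n)
        ≈⟨ +-cong (root-pow-recurrence x²≈x-q n) (-‿cong (root-pow-recurrence y²≈y-q n)) ⟩
      (x₁ - q * x₀) - (y₁ - q * y₀)
        ≈⟨ solve 5 (λ x₁ x₀ y₁ y₀ q → (x₁ :- q :* x₀) :- (y₁ :- q :* y₀) := (x₁ :- y₁) :- q :* (x₀ :- y₀)) refl x₁ x₀ y₁ y₀ q ⟩
      (x₁ - y₁) - q * (x₀ - y₀)
        ≈⟨ +-cong (binet-lucasU (suc n)) (-‿cong (*-congˡ (binet-lucasU n))) ⟩
      (x - y) * u₁ - q * ((x - y) * u₀)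
        ≈⟨ solve 4 (λ d u₁ u₀ q → d :* u₁ :- q :* (d :* u₀) := d :* (u₁ :- q :* u₀)) refl (x - y) u₁ u₀ q ⟩
      (x - y) * lucasU R q (2 ℕ.+ n) ∎
      where
      x₁ x₀ y₁ y₀ u₁ u₀ : Carrier
      x₁ = pow R x (suc n); x₀ = pow R x n
      y₁ = pow R y (suc n); y₀ = pow R y n
      u₁ = lucasU R q (suc n); u₀ = lucasU R q n

    binet-lucasV : ∀ n → pow R x n + pow R y n ≈ lucasV R q n
    binet-lucasV zero          = refl
    binet-lucasV (suc zero)    = trans (+-cong (*-identityʳ x) (*-identityʳ y)) x+y≈1
    binet-lucasV (suc (suc n)) = begin
      pow R x (2 ℕ.+ n) + pow R y (2 ℕ.+ n)
        ≈⟨ +-cong (root-pow-recurrence x²≈x-q n) (root-pow-recurrence y²≈y-q n) ⟩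
      (x₁ - q * x₀) + (y₁ - q * y₀)
        ≈⟨ solve 5 (λ x₁ x₀ y₁ y₀ q → (x₁ :- q :* x₀) :+ (y₁ :- q :* y₀) := (x₁ :+ y₁) :- q :* (x₀ :+ y₀)) refl x₁ x₀ y₁ y₀ q ⟩
      (x₁ + y₁) - q * (x₀ + y₀)
        ≈⟨ +-cong (binet-lucasV (suc n)) (-‿cong (*-congˡ (binet-lucasV n))) ⟩
      lucasV R q (2 ℕ.+ n) ∎
      where
      x₁ x₀ y₁ y₀ : Carrier
      x₁ = pow R x (suc n); x₀ = pow R x n
      y₁ = pow R y (suc n); y₀ = pow R y n

    binet-polynomial-lucasU : ∀ a j s →
      pow R x s * polynomial a j x - pow R y s * polynomial a j y
        ≈ (x - y) * Σ≤ R j (λ t → a t * lucasU R q (t ℕ.+ s))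
    binet-polynomial-lucasU a j s = begin
      pow R x s * polynomial a j x - pow R y s * polynomial a j y
        ≈⟨ +-cong (pow-*-polynomial a j s x) (-‿cong (pow-*-polynomial a j s y)) ⟩
      Σ≤ R j (λ t → a t * pow R x (t ℕ.+ s)) - Σ≤ R j (λ t → a t * pow R y (t ℕ.+ s))
        ≈⟨ sym (Σ≤-distrib-sub j _ _) ⟩
      Σ≤ R j (λ t → a t * pow R x (t ℕ.+ s) - a t * pow R y (t ℕ.+ s))
        ≈⟨ Σ≤-cong j (λ t → begin
          a t * pow R x (t ℕ.+ s) - a t * pow R y (t ℕ.+ s)
            ≈⟨ sym (x[y-z]≈xy-xz _ _ _) ⟩
          a t * (pow R x (t ℕ.+ s) - pow R y (t ℕ.+ s))
            ≈⟨ *-congˡ (binet-lucasU (t ℕ.+ s)) ⟩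
          a t * ((x - y) * lucasU R q (t ℕ.+ s))
            ≈⟨ x∙yz≈y∙xz _ _ _ ⟩
          (x - y) * (a t * lucasU R q (t ℕ.+ s)) ∎) ⟩
      Σ≤ R j (λ t → (x - y) * (a t * lucasU R q (t ℕ.+ s)))
        ≈⟨ sym (*-distribˡ-Σ≤ j _ _) ⟩
      (x - y) * Σ≤ R j (λ t → a t * lucasU R q (t ℕ.+ s)) ∎

    binet-polynomial-lucasV : ∀ a j s →
      pow R x s * polynomial a j x + pow R y s * polynomial a j y
        ≈ Σ≤ R j (λ t → a t * lucasV R q (t ℕ.+ s))
    binet-polynomial-lucasV a j s = begin
      pow R x s * polynomial a j x + pow R y s * polynomial a j y
        ≈⟨ +-cong (pow-*-polynomial a j s x) (pow-*-polynomial a j s y) ⟩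
      Σ≤ R j (λ t → a t * pow R x (t ℕ.+ s)) + Σ≤ R j (λ t → a t * pow R y (t ℕ.+ s))
        ≈⟨ sym (Σ≤-distrib-+ j _ _) ⟩
      Σ≤ R j (λ t → a t * pow R x (t ℕ.+ s) + a t * pow R y (t ℕ.+ s))
        ≈⟨ Σ≤-cong j (λ t → trans (sym (distribˡ _ _ _)) (*-congˡ (binet-lucasV (t ℕ.+ s)))) ⟩
      Σ≤ R j (λ t → a t * lucasV R q (t ℕ.+ s)) ∎

  module Roots {q Δ half : Carrier} (half+half≈1 : half + half ≈ 1#)
               (Δ²≈1-4q : Δ * Δ ≈ 1# - fromℕ R 4 * q) where

    τ σ : Carrier
    τ = half * (1# + Δ)
    σ = half * (1# - Δ)

    -- 1# enters the solver as a variable, since con (+ 1) denotes 1# + 0#;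
    -- con (+ 4) denotes fromℕ R 4 on the nose.
    τ+σ≈1 : τ + σ ≈ 1#
    τ+σ≈1 = begin
      τ + σ                 ≈⟨ solve 3 (λ h o d → h :* (o :+ d) :+ h :* (o :- d) := (h :+ h) :* o) refl half 1# Δ ⟩
      (half + half) * 1#    ≈⟨ *-congʳ half+half≈1 ⟩
      1# * 1#               ≈⟨ *-identityˡ 1# ⟩
      1#                    ∎

    τ-σ≈Δ : τ - σ ≈ Δ
    τ-σ≈Δ = begin
      τ - σ                 ≈⟨ solve 3 (λ h o d → h :* (o :+ d) :- h :* (o :- d) := (h :+ h) :* d) refl half 1# Δ ⟩
      (half + half) * Δ     ≈⟨ *-congʳ half+half≈1 ⟩
      1# * Δ                ≈⟨ *-identityˡ Δ ⟩
      Δ                     ∎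

    τ*σ≈q : τ * σ ≈ q
    τ*σ≈q = begin
      τ * σ
        ≈⟨ solve 3 (λ h o d → h :* (o :+ d) :* (h :* (o :- d)) := h :* h :* (o :* o :- d :* d)) refl half 1# Δ ⟩
      half * half * (1# * 1# - Δ * Δ)
        ≈⟨ *-congˡ (+-cong (*-identityˡ 1#) (-‿cong Δ²≈1-4q)) ⟩
      half * half * (1# - (1# - fromℕ R 4 * q))
        ≈⟨ solve 3 (λ h o q → h :* h :* (o :- (o :- con (+ 4) :* q)) := (h :+ h) :* (h :+ h) :* q) refl half 1# q ⟩
      (half + half) * (half + half) * q
        ≈⟨ *-congʳ (*-cong half+half≈1 half+half≈1) ⟩
      1# * 1# * q
        ≈⟨ trans (*-congʳ (*-identityˡ 1#)) (*-identityˡ q) ⟩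
      q ∎

open import Data.Nat using (_+_)

lemma6 : ∀ {c ℓ : Level} (R : CommutativeRing c ℓ) →
    let open CommutativeRing R renaming (_+_ to _+ᴿ_) in
    (q Δ half : Carrier) →
    ¬ (q ≈ 0#) →
    half +ᴿ half ≈ 1# →
    Δ * Δ ≈ 1# - fromℕ R 4 * q →
    let τ = half * (1# +ᴿ Δ)
        σ = half * (1# - Δ)
    in (j s : ℕ) →
      (pow R τ s * eulerPoly R j τ - pow R σ s * eulerPoly R j σ
         ≈ Δ * Σ≤ R j (λ t → fromℤ R (euler j t) * lucasU R q (t + s)))
      × (pow R τ s * eulerPoly R j τ +ᴿ pow R σ s * eulerPoly R j σ
         ≈ Σ≤ R j (λ t → fromℤ R (euler j t) * lucasV R q (t + s)))
lemma6 R q Δ half _ half+half≈1 Δ²≈1-4q j s =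
  trans (binet-polynomial-lucasU R τ+σ≈1 τ*σ≈q eulerian j s) (*-congʳ τ-σ≈Δ) ,
  binet-polynomial-lucasV R τ+σ≈1 τ*σ≈q eulerian j s
  where
  open CommutativeRing R using (trans; *-congʳ)
  open Roots R half+half≈1 Δ²≈1-4q
  eulerian : ℕ → CommutativeRing.Carrier R
  eulerian t = fromℤ R (euler j t)
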